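{- Let $G$ be a $3$-rank-connected graph with $|V(G)|\ge 12$ and $x\in V(G)$. Let $P$ be a quad of $G\setminus x$, $y\in P$, and $Q$ a quad of $G\setminus y$. If $G\setminus x$ is weakly $3$-rank-connected and $|P\cap Q|=2$, then $x\in Q$.
   Context: Graphs are finite and simple; $G\setminus v$ is deletion. The cut-rank $\rho_G(X)$ is the $\mathrm{GF}(2)$-rank of the $X\times(V(G)-X)$ submatrix of the adjacency matrix. $G$ is $k$-rank-connected if there is no partition $(A,B)$ of $V(G)$ with $|A|,|B|>\rho_G(A)$ and $\rho_G(A)<k$; prime means $2$-rank-connected. $G$ is weakly $3$-rank-connected if it is prime and no $X\subseteq V(G)$ has $|X|\ge5$, $|V(G)-X|\ge5$, $\rho_G(X)\le2$. A quad of $G$ is a $4$-element $P\subseteq V(G)$ with $\rho_G(P)=2$ and $\rho_G(P-\{z\})=3$ for each $z\in P$. -}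

module Defs where

open import Data.Nat using (ℕ; zero; suc; _<_; _≤_)
open import Data.Bool using (Bool; true; false; _∧_; _xor_)
open import Data.Fin using (Fin)
import Data.Fin as F
open import Data.Fin.Subset using (Subset; _∈_; _⊆_; _─_; ∣_∣; Nonempty; ⁅_⁆; ⊤; ∁)
open import Data.Vec using (lookup)
open import Data.Product using (Σ; _×_; _,_)
open import Relation.Binary.PropositionalEquality using (_≡_)
open import Relation.Nullary using (¬_)

record Graph (n : ℕ) : Set where
  field
    adj   : Fin n → Fin n → Bool
    sym   : ∀ u v → adj u v ≡ adj v u
    loopless : ∀ v → adj v v ≡ false
open Graph public

xorSum : ∀ m → (Fin m → Bool) → Bool
xorSum zero    f = false
xorSum (suc m) f = f F.zero xor xorSum m (λ i → f (F.suc i))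

_∈ᵇ_ : ∀ {n} → Fin n → Subset n → Bool
v ∈ᵇ X = lookup X v

-- We work with induced subgraphs G[W] for W ⊆ V(G); G ∖ x is G[V(G) - {x}].
-- Row of vertex u in the X × (W − X) submatrix of the adjacency matrix of
-- G[W] (columns outside W − X are padded with zeros, which does not change rank).
cutRow : ∀ {n} → Graph n → Subset n → Subset n → Fin n → Fin n → Bool
cutRow G W X u v = (v ∈ᵇ (W ─ X)) ∧ adj G u v

rowSum : ∀ {n} → Graph n → Subset n → Subset n → Subset n → Fin n → Bool
rowSum {n} G W X T v = xorSum n (λ u → (u ∈ᵇ T) ∧ cutRow G W X u v)

RowsIndependent : ∀ {n} → Graph n → Subset n → Subset n → Subset n → Set
RowsIndependent {n} G W X S =
  ∀ (T : Subset n) → T ⊆ S → Nonempty T → ¬ (∀ v → rowSum G W X T v ≡ false)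

-- CutRank G W X r : the cut-rank ρ_{G[W]}(X) equals r, i.e. the GF(2)-rank of
-- the X × (W − X) submatrix of the adjacency matrix of G[W] is r
-- (maximum number of linearly independent rows). Intended for X ⊆ W.
CutRank : ∀ {n} → Graph n → Subset n → Subset n → ℕ → Set
CutRank {n} G W X r =
  Σ (Subset n) (λ S → S ⊆ X × ∣ S ∣ ≡ r × RowsIndependent G W X S)
  × (∀ (S : Subset n) → S ⊆ X → RowsIndependent G W X S → ∣ S ∣ ≤ r)

RankConnected : ∀ {n} → ℕ → Graph n → Subset n → Set
RankConnected {n} k G W =
  ∀ (A : Subset n) (r : ℕ) → A ⊆ W → CutRank G W A r → r < k →
    ¬ (r < ∣ A ∣ × r < ∣ W ─ A ∣)

Prime : ∀ {n} → Graph n → Subset n → Set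
Prime = RankConnected 2

WeaklyThreeRankConnected : ∀ {n} → Graph n → Subset n → Set
WeaklyThreeRankConnected {n} G W =
  Prime G W ×
  (∀ (X : Subset n) (r : ℕ) → X ⊆ W → 5 ≤ ∣ X ∣ → 5 ≤ ∣ W ─ X ∣ →
     CutRank G W X r → ¬ (r ≤ 2))

Quad : ∀ {n} → Graph n → Subset n → Subset n → Set
Quad {n} G W P =
  P ⊆ W × ∣ P ∣ ≡ 4 × CutRank G W P 2 ×
  (∀ z → z ∈ P → CutRank G W (P ─ ⁅ z ⁆) 3)

V : ∀ {n} → Subset n
V = ⊤

del : ∀ {n} → Fin n → Subset n
del x = ∁ ⁅ x ⁆

{-# OPTIONS --safe #-}
-- Suppose x ∉ Q, so that P ∪ Q avoids x, and write P = {a, b, y, z} with P ∩ Q = {a, b}.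
-- In G ∖ x, on the columns outside P, the rows of a, b, y satisfy a relation τ because P has
-- cut-rank 2, and τ is nonzero in column z because P − z has cut-rank 3; the same two facts put
-- the row of z in the span of the rows of a, b, y.  In G ∖ y the rows of Q are spanned by those
-- of two of its vertices q₁, q₂.  Hence on the columns C outside P ∪ Q every row of P ∪ Q is a
-- combination of the rows of q₁, q₂, y, and τ rewritten in these generators is a relation among
-- them which is nonzero in column z.  So ρ(P ∪ Q) ≤ 2 although |P ∪ Q| = 6 and |C| ≥ 5,
-- contradicting the weak 3-rank-connectivity of G ∖ x.
module Submission where

open import Defs hiding (sym)

open import Algebra.Bundles using (CommutativeRing)
open import Data.Bool using (Bool; true; false; _∧_; _xor_)
open import Data.Bool.Properties
  using (xor-∧-commutativeRing; ∧-assoc; ∧-comm; ∧-zeroʳ; ∧-identityʳ; ∧-distribʳ-xor; xor-identityʳ)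
  renaming (_≟_ to _≟ᵇ_)
open import Data.Empty using (⊥-elim)
open import Data.Fin using (Fin; zero; suc; _≟_)
open import Data.Fin.Properties using (punchInᵢ≢i; all?; any?) renaming (suc-injective to Fin-suc-injective)
open import Data.Fin.Subset
  using (Subset; _∈_; _∉_; _⊆_; _─_; _-_; _∩_; _∪_; ∣_∣; Nonempty; ⁅_⁆; ⊥; inside; outside)
open import Data.Fin.Subset.Properties
  using (_∈?_; _⊆?_; nonempty?; anySubset?; ⊆-min; ∉⊥; ∣⊥∣≡0; ∣p∣≤n; ∣⁅x⁆∣≡1; ∣∁p∣≡n∸∣p∣;
         ∣p∩q∣≤∣q∣; p⊆q⇒∣p∣≤∣q∣; x∈p⇒∣p-x∣<∣p∣; x∈⁅x⁆; x∈⁅y⁆⇒x≡y; x≢y⇒x∉⁅y⁆; x∈∁p⇒x∉p; x∉p⇒x∈∁p;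
         x∈p∪q⁺; x∈p∪q⁻; x∈p∩q⁻; p─⊥≡p; p─q⊆p; x∈p∧x∉q⇒x∈p─q; x∈p∧x≢y⇒x∈p-y)
open import Data.Nat using (ℕ; zero; suc; _+_; _∸_; _<_; _≤_; z≤n; s≤s; s≤s⁻¹)
open import Data.Nat.Properties
  using (_≤?_; ≤-refl; ≤-trans; n≤1+n; ≤-<-trans; <⇒≱; ≰⇒>; ≤∧≢⇒<; +-suc; suc-injective;
         +-cancelˡ-≡; +-cancelʳ-≡; +-cancelˡ-≤; +-monoˡ-≤; ∸-monoˡ-≤)
  renaming (_≟_ to _≟ℕ_)
open import Data.Product using (∃; _×_; _,_; proj₁; proj₂; map₂)
open import Data.Sum using (_⊎_; inj₁; inj₂)
import Data.Sum
open import Data.Vec using ([]; _∷_; here; there; lookup; tabulate)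
open import Data.Vec.Properties using ([]=⇒lookup; lookup⇒[]=; lookup∘tabulate)
open import Data.Vec.Functional using (updateAt; removeAt)
open import Data.Vec.Functional.Properties using (updateAt-updates; updateAt-minimal; map-updateAt-local)
open import Function using (_∘_; const; case_of_)
open import Function.Definitions using (Injective)
open import Relation.Binary.PropositionalEquality
  using (_≡_; _≢_; _≗_; refl; sym; trans; cong; cong₂; subst; subst₂; module ≡-Reasoning)
open import Relation.Nullary using (¬_; Dec; yes; no; ¬?)
open import Relation.Nullary.Decidable
  using (_×-dec_; _⊎-dec_; _→-dec_; map′; decidable-stable; from-yes)
open import Relation.Unary using (Decidable)

open import Algebra.Properties.Semiring.Sum (CommutativeRing.semiring xor-∧-commutativeRing)
  using (sum; sum-cong-≗; sum-remove; sum-replicate-zero; ∑-distrib-+; ∑-comm;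
         *-distribˡ-sum; *-distribʳ-sum)

-- Linear combinations of rows over GF(2)

Row : ℕ → Set
Row n = Fin n → Bool

lincomb : ∀ {m n} → (Fin m → Bool) → (Fin m → Row n) → Row n
lincomb c f v = sum (λ i → c i ∧ f i v)

Nontrivial : ∀ {m} → (Fin m → Bool) → Set
Nontrivial c = ∃ λ i → c i ≡ true

VanishesOn : ∀ {n} → Subset n → Row n → Set
VanishesOn K f = ∀ v → v ∈ K → f v ≡ false

InSpan : ∀ {m n} → Subset n → (Fin m → Row n) → Row n → Set
InSpan K f g = ∃ λ σ → ∀ v → v ∈ K → g v ≡ lincomb σ f v

sum-false : ∀ {m} (t : Fin m → Bool) → (∀ i → t i ≡ false) → sum t ≡ false
sum-false {m} t t≗0 = trans (sum-cong-≗ t≗0) (sum-replicate-zero m)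

sum-single : ∀ {m} (t : Fin (suc m) → Bool) k → (∀ i → i ≢ k → t i ≡ false) → sum t ≡ t k
sum-single t k off = begin
  sum t                             ≡⟨ sum-remove {i = k} t ⟩
  t k xor sum (removeAt t k)        ≡⟨ cong (t k xor_) (sum-false _ (λ j → off _ (punchInᵢ≢i k j))) ⟩
  t k xor false                     ≡⟨ xor-identityʳ (t k) ⟩
  t k                               ∎
  where open ≡-Reasoning

sum-true : ∀ {m} (t : Fin m → Bool) → sum t ≡ true → ∃ λ i → t i ≡ true
sum-true {suc m} t s with t zero in t₀
... | true  = zero , t₀
... | false with sum-true (t ∘ suc) s
...   | i , tᵢ = suc i , tᵢ

∧≡true : ∀ {x y} → x ∧ y ≡ true → x ≡ true × y ≡ true
∧≡true {true} y≡true = refl , y≡true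

xor≡false⇒≡ : ∀ {x y} → x xor y ≡ false → x ≡ y
xor≡false⇒≡ {false} {false} _ = refl
xor≡false⇒≡ {true}  {true}  _ = refl

lincomb-true : ∀ {m n} c (f : Fin m → Row n) v → lincomb c f v ≡ true →
  ∃ λ i → c i ≡ true × f i v ≡ true
lincomb-true c f v e with sum-true _ e
... | i , cᵢfᵢ = i , ∧≡true cᵢfᵢ

lincomb-xor : ∀ {m n} c d (f : Fin m → Row n) v →
  lincomb (λ i → c i xor d i) f v ≡ lincomb c f v xor lincomb d f v
lincomb-xor c d f v =
  trans (sum-cong-≗ (λ i → ∧-distribʳ-xor (f i v) (c i) (d i)))
        (∑-distrib-+ (λ i → c i ∧ f i v) (λ i → d i ∧ f i v))

lincomb-assoc : ∀ {l m n} c (σ : Fin l → Fin m → Bool) (g : Fin m → Row n) v →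
  lincomb c (λ i → lincomb (σ i) g) v ≡ lincomb (lincomb c σ) g v
lincomb-assoc c σ g v = begin
  sum (λ i → c i ∧ sum (λ j → σ i j ∧ g j v))
    ≡⟨ sum-cong-≗ (λ i → *-distribˡ-sum (c i) (λ j → σ i j ∧ g j v)) ⟩
  sum (λ i → sum (λ j → c i ∧ (σ i j ∧ g j v)))
    ≡⟨ ∑-comm (λ i j → c i ∧ (σ i j ∧ g j v)) ⟩
  sum (λ j → sum (λ i → c i ∧ (σ i j ∧ g j v)))
    ≡⟨ sum-cong-≗ (λ j → sum-cong-≗ (λ i → sym (∧-assoc (c i) (σ i j) (g j v)))) ⟩
  sum (λ j → sum (λ i → (c i ∧ σ i j) ∧ g j v))
    ≡⟨ sum-cong-≗ (λ j → sym (*-distribʳ-sum (g j v) (λ i → c i ∧ σ i j))) ⟩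
  sum (λ j → sum (λ i → c i ∧ σ i j) ∧ g j v)       ∎
  where open ≡-Reasoning

lincomb-subst : ∀ {l m n} {K : Subset n} (f : Fin l → Row n) (g : Fin m → Row n) σ →
  (∀ i v → v ∈ K → f i v ≡ lincomb (σ i) g v) →
  ∀ c v → v ∈ K → lincomb c f v ≡ lincomb (lincomb c σ) g v
lincomb-subst f g σ f≡σg c v v∈K =
  trans (sum-cong-≗ (λ i → cong (c i ∧_) (f≡σg i v v∈K))) (lincomb-assoc c σ g v)

lincomb-updateAt-unused : ∀ {m n} c (f : Fin m → Row n) k h → c k ≡ false →
  lincomb c (updateAt f k h) ≗ lincomb c f
lincomb-updateAt-unused c f k h cₖ≡false v = sum-cong-≗ term
  where
  term : ∀ i → c i ∧ updateAt f k h i v ≡ c i ∧ f i v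
  term i with i ≟ k
  ... | yes refl rewrite cₖ≡false = refl
  ... | no i≢k   = cong (λ fᵢ → c i ∧ fᵢ v) (updateAt-minimal i k f i≢k)

lincomb-split : ∀ {m n} c (f : Fin m → Row n) k v →
  lincomb c f v ≡ (c k ∧ f k v) xor lincomb (updateAt c k (const false)) f v
lincomb-split {suc m} c f k v = begin
  sum t                               ≡⟨ sum-remove {i = k} t ⟩
  t k xor sum (removeAt t k)          ≡⟨ cong (t k xor_) (sum-cong-≗ (λ j → sym (t′≗t (punchInᵢ≢i k j)))) ⟩
  t k xor sum (removeAt t′ k)         ≡⟨ cong (λ b → t k xor (b xor sum (removeAt t′ k))) (sym t′ₖ≡false) ⟩
  t k xor (t′ k xor sum (removeAt t′ k)) ≡⟨ cong (t k xor_) (sym (sum-remove {i = k} t′)) ⟩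
  t k xor sum t′                      ∎
  where
  open ≡-Reasoning
  t t′ : Fin (suc m) → Bool
  t i = c i ∧ f i v
  t′ i = updateAt c k (const false) i ∧ f i v
  t′≗t : ∀ {i} → i ≢ k → t′ i ≡ t i
  t′≗t i≢k = cong (_∧ _) (updateAt-minimal _ k c i≢k)
  t′ₖ≡false : t′ k ≡ false
  t′ₖ≡false = cong (_∧ f k v) (updateAt-updates k c)

-- If d did not involve the k-th row, τ + d would be a relation vanishing on K but zero at z.
exchange : ∀ {m n} {K : Subset n} {z} (f : Fin m → Row n) (g : Row n) k →
  (∀ c → Nontrivial c → VanishesOn K (lincomb c f) → lincomb c f z ≡ true) →
  ∀ τ → τ k ≡ true → VanishesOn K (lincomb τ f) →
  ∀ d → Nontrivial d → VanishesOn K (lincomb d (updateAt f k (const g))) →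
  InSpan K f g
exchange {K = K} {z} f g k detects τ τₖ τ-vanishes d d-nontrivial d-vanishes with d k in dₖ
... | true = updateAt d k (const false) , λ v v∈ → xor≡false⇒≡ (trans (sym (split v)) (d-vanishes v v∈))
  where
  split : ∀ v → lincomb d (updateAt f k (const g)) v ≡ g v xor lincomb (updateAt d k (const false)) f v
  split v = trans (lincomb-split d (updateAt f k (const g)) k v)
    (cong₂ _xor_ (cong₂ _∧_ dₖ (cong (λ h → h v) (updateAt-updates k f)))
                 (lincomb-updateAt-unused _ f k (const g) (updateAt-updates k d) v))
... | false = ⊥-elim (case trans (sym (detects τ⊕d τ⊕d-nontrivial τ⊕d-vanishes)) τ⊕d-at-z of λ ())
  where
  d-vanishes′ : VanishesOn K (lincomb d f)
  d-vanishes′ v v∈ = trans (sym (lincomb-updateAt-unused d f k (const g) dₖ v)) (d-vanishes v v∈)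
  τ⊕d : Fin _ → Bool
  τ⊕d i = τ i xor d i
  τ⊕d-nontrivial : Nontrivial τ⊕d
  τ⊕d-nontrivial = k , cong₂ _xor_ τₖ dₖ
  τ⊕d-vanishes : VanishesOn K (lincomb τ⊕d f)
  τ⊕d-vanishes v v∈ = trans (lincomb-xor τ d f v) (cong₂ _xor_ (τ-vanishes v v∈) (d-vanishes′ v v∈))
  τ⊕d-at-z : lincomb τ⊕d f z ≡ false
  τ⊕d-at-z = trans (lincomb-xor τ d f z)
    (cong₂ _xor_ (detects τ (k , τₖ) τ-vanishes) (detects d d-nontrivial d-vanishes′))

-- Finite sets

∉⇒lookup≡false : ∀ {n} {p : Subset n} {x} → x ∉ p → lookup p x ≡ false
∉⇒lookup≡false {p = p} {x} x∉p with lookup p x in e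
... | true  = ⊥-elim (x∉p (lookup⇒[]= x p e))
... | false = refl

lookup-⁅⁆-≢ : ∀ {n} {x y : Fin n} → x ≢ y → lookup ⁅ y ⁆ x ≡ false
lookup-⁅⁆-≢ x≢y = ∉⇒lookup≡false (x≢y⇒x∉⁅y⁆ x≢y)

lookup-p-x : ∀ {n} (p : Subset n) x → lookup (p - x) ≗ updateAt (lookup p) x (const false)
lookup-p-x (b ∷ p) zero    zero    = refl
lookup-p-x (b ∷ p) zero    (suc i) = cong (λ q → lookup q i) (p─⊥≡p p)
lookup-p-x (b ∷ p) (suc x) zero    = refl
lookup-p-x (b ∷ p) (suc x) (suc i) = lookup-p-x p x i

x∈p─q⇒x∉q : ∀ {n} {p q : Subset n} {x} → x ∈ p ─ q → x ∉ q
x∈p─q⇒x∉q {p = inside ∷ p} {outside ∷ q} here       ()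
x∈p─q⇒x∉q {p = _ ∷ p}      {_ ∷ q}       (there x∈) (there x∈q) = x∈p─q⇒x∉q x∈ x∈q

∣p∣≡1+∣p-x∣ : ∀ {n} (p : Subset n) {x} → x ∈ p → ∣ p ∣ ≡ suc ∣ p - x ∣
∣p∣≡1+∣p-x∣ (inside ∷ p)  here      = cong suc (cong ∣_∣ (sym (p─⊥≡p p)))
∣p∣≡1+∣p-x∣ (inside ∷ p)  (there x∈p) = cong suc (∣p∣≡1+∣p-x∣ p x∈p)
∣p∣≡1+∣p-x∣ (outside ∷ p) (there x∈p) = ∣p∣≡1+∣p-x∣ p x∈p

∣p∣≡0⇒x∉p : ∀ {n} {p : Subset n} {x} → ∣ p ∣ ≡ 0 → x ∉ p
∣p∣≡0⇒x∉p {p = p} ∣p∣≡0 x∈p with trans (sym ∣p∣≡0) (∣p∣≡1+∣p-x∣ p x∈p)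
... | ()

0<∣p∣⇒nonempty : ∀ {n} (p : Subset n) → 0 < ∣ p ∣ → Nonempty p
0<∣p∣⇒nonempty (inside ∷ p)  _ = zero , here
0<∣p∣⇒nonempty (outside ∷ p) 0<∣p∣ with 0<∣p∣⇒nonempty p 0<∣p∣
... | x , x∈p = suc x , there x∈p

∣p∣≡∣p∩q∣+∣p─q∣ : ∀ {n} (p q : Subset n) → ∣ p ∣ ≡ ∣ p ∩ q ∣ + ∣ p ─ q ∣
∣p∣≡∣p∩q∣+∣p─q∣ []            []            = refl
∣p∣≡∣p∩q∣+∣p─q∣ (inside ∷ p)  (inside ∷ q)  = cong suc (∣p∣≡∣p∩q∣+∣p─q∣ p q)
∣p∣≡∣p∩q∣+∣p─q∣ (inside ∷ p)  (outside ∷ q) = trans (cong suc (∣p∣≡∣p∩q∣+∣p─q∣ p q)) (sym (+-suc _ _))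
∣p∣≡∣p∩q∣+∣p─q∣ (outside ∷ p) (inside ∷ q)  = ∣p∣≡∣p∩q∣+∣p─q∣ p q
∣p∣≡∣p∩q∣+∣p─q∣ (outside ∷ p) (outside ∷ q) = ∣p∣≡∣p∩q∣+∣p─q∣ p q

∣p∣≤∣q∣+∣p─q∣ : ∀ {n} (p q : Subset n) → ∣ p ∣ ≤ ∣ q ∣ + ∣ p ─ q ∣
∣p∣≤∣q∣+∣p─q∣ p q =
  subst (_≤ ∣ q ∣ + ∣ p ─ q ∣) (sym (∣p∣≡∣p∩q∣+∣p─q∣ p q)) (+-monoˡ-≤ ∣ p ─ q ∣ (∣p∩q∣≤∣q∣ p q))

∣p∪q∣+∣p∩q∣≡∣p∣+∣q∣ : ∀ {n} (p q : Subset n) → ∣ p ∪ q ∣ + ∣ p ∩ q ∣ ≡ ∣ p ∣ + ∣ q ∣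
∣p∪q∣+∣p∩q∣≡∣p∣+∣q∣ []            []            = refl
∣p∪q∣+∣p∩q∣≡∣p∣+∣q∣ (inside ∷ p)  (inside ∷ q)  =
  cong suc (trans (+-suc _ _) (trans (cong suc (∣p∪q∣+∣p∩q∣≡∣p∣+∣q∣ p q)) (sym (+-suc _ _))))
∣p∪q∣+∣p∩q∣≡∣p∣+∣q∣ (inside ∷ p)  (outside ∷ q) = cong suc (∣p∪q∣+∣p∩q∣≡∣p∣+∣q∣ p q)
∣p∪q∣+∣p∩q∣≡∣p∣+∣q∣ (outside ∷ p) (inside ∷ q)  =
  trans (cong suc (∣p∪q∣+∣p∩q∣≡∣p∣+∣q∣ p q)) (sym (+-suc _ _))
∣p∪q∣+∣p∩q∣≡∣p∣+∣q∣ (outside ∷ p) (outside ∷ q) = ∣p∪q∣+∣p∩q∣≡∣p∣+∣q∣ p q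

⊆-by-size : ∀ {n} {p q : Subset n} → p ⊆ q → ∣ q ∣ ≤ ∣ p ∣ → q ⊆ p
⊆-by-size {p = p} {q} p⊆q ∣q∣≤∣p∣ {x} x∈q with x ∈? p
... | yes x∈p = x∈p
... | no  x∉p = ⊥-elim (<⇒≱ (≤-<-trans (p⊆q⇒∣p∣≤∣q∣ p⊆q-x) (x∈p⇒∣p-x∣<∣p∣ x∈q)) ∣q∣≤∣p∣)
  where
  p⊆q-x : p ⊆ q - x
  p⊆q-x {y} y∈p = x∈p∧x≢y⇒x∈p-y (p⊆q y∈p) (λ { refl → x∉p y∈p })

∣p∣≡2⇒pair : ∀ {n} {p : Subset n} {a} → ∣ p ∣ ≡ 2 → a ∈ p →
  ∃ λ b → b ∈ p × b ≢ a × (∀ {w} → w ∈ p → w ≡ a ⊎ w ≡ b)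
∣p∣≡2⇒pair {n} {p} {a} ∣p∣≡2 a∈p = b , p─q⊆p p ⁅ a ⁆ b∈p-a , b≢a , pair
  where
  ∣p-a∣≡1 : ∣ p - a ∣ ≡ 1
  ∣p-a∣≡1 = suc-injective (trans (sym (∣p∣≡1+∣p-x∣ p a∈p)) ∣p∣≡2)
  b-witness : Nonempty (p - a)
  b-witness = 0<∣p∣⇒nonempty (p - a) (subst (0 <_) (sym ∣p-a∣≡1) (s≤s z≤n))
  b : Fin n
  b = proj₁ b-witness
  b∈p-a : b ∈ p - a
  b∈p-a = proj₂ b-witness
  b≢a : b ≢ a
  b≢a b≡a = x∈p─q⇒x∉q b∈p-a (subst (_∈ ⁅ a ⁆) (sym b≡a) (x∈⁅x⁆ a))
  ∣p-a-b∣≡0 : ∣ p - a - b ∣ ≡ 0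
  ∣p-a-b∣≡0 = suc-injective (trans (sym (∣p∣≡1+∣p-x∣ (p - a) b∈p-a)) ∣p-a∣≡1)
  pair : ∀ {w} → w ∈ p → w ≡ a ⊎ w ≡ b
  pair {w} w∈p with w ≟ a | w ≟ b
  ... | yes w≡a | _       = inj₁ w≡a
  ... | no _    | yes w≡b = inj₂ w≡b
  ... | no w≢a  | no w≢b  = ⊥-elim (∣p∣≡0⇒x∉p ∣p-a-b∣≡0 (x∈p∧x≢y⇒x∈p-y (x∈p∧x≢y⇒x∈p-y w∈p w≢a) w≢b))

injection⇒≤∣∣ : ∀ {m n} {A : Subset n} (p : Fin m → Fin n) → Injective _≡_ _≡_ p →
  (∀ i → p i ∈ A) → m ≤ ∣ A ∣
injection⇒≤∣∣ {zero}          p p-inj p∈A = z≤n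
injection⇒≤∣∣ {suc m} {A = A} p p-inj p∈A =
  ≤-trans (s≤s (injection⇒≤∣∣ (p ∘ suc) (Fin-suc-injective ∘ p-inj) p∘suc∈A-p₀))
          (x∈p⇒∣p-x∣<∣p∣ (p∈A zero))
  where
  p∘suc∈A-p₀ : ∀ i → p (suc i) ∈ A - p zero
  p∘suc∈A-p₀ i = x∈p∧x≢y⇒x∈p-y (p∈A (suc i)) (λ e → case p-inj e of λ ())

≤∣∣⇒injection : ∀ {m n} (A : Subset n) → m ≤ ∣ A ∣ →
  ∃ λ (p : Fin m → Fin n) → Injective _≡_ _≡_ p × (∀ i → p i ∈ A)
≤∣∣⇒injection {zero}  A _ = (λ ()) , (λ { {()} }) , (λ ())
≤∣∣⇒injection {suc m} A m<∣A∣ with 0<∣p∣⇒nonempty A (≤-trans (s≤s z≤n) m<∣A∣)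
... | u , u∈A with ≤∣∣⇒injection (A - u) (s≤s⁻¹ (subst (suc m ≤_) (∣p∣≡1+∣p-x∣ A u∈A) m<∣A∣))
...   | q , q-inj , q∈A-u = p , p-inj , p∈A
  where
  p : Fin (suc m) → Fin _
  p zero    = u
  p (suc i) = q i
  q≢u : ∀ i → q i ≢ u
  q≢u i qᵢ≡u = x∈p─q⇒x∉q (q∈A-u i) (subst (_∈ ⁅ u ⁆) (sym qᵢ≡u) (x∈⁅x⁆ u))
  p-inj : Injective _≡_ _≡_ p
  p-inj {zero}  {zero}  _ = refl
  p-inj {zero}  {suc j} e = ⊥-elim (q≢u j (sym e))
  p-inj {suc i} {zero}  e = ⊥-elim (q≢u i e)
  p-inj {suc i} {suc j} e = cong suc (q-inj e)
  p∈A : ∀ i → p i ∈ A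
  p∈A zero    = u∈A
  p∈A (suc i) = p─q⊆p A ⁅ u ⁆ (q∈A-u i)

updateAt-injective : ∀ {m n} {p : Fin m → Fin n} {u} k → Injective _≡_ _≡_ p → (∀ i → p i ≢ u) →
  Injective _≡_ _≡_ (updateAt p k (const u))
updateAt-injective {p = p} {u} k p-inj p≢u {i} {j} e with i ≟ k | j ≟ k
... | yes refl | yes refl = refl
... | yes refl | no  j≢k  =
  ⊥-elim (p≢u j (trans (sym (updateAt-minimal j k p j≢k)) (trans (sym e) (updateAt-updates k p))))
... | no  i≢k  | yes refl =
  ⊥-elim (p≢u i (trans (sym (updateAt-minimal i k p i≢k)) (trans e (updateAt-updates k p))))
... | no  i≢k  | no  j≢k  =
  p-inj (trans (sym (updateAt-minimal i k p i≢k)) (trans e (updateAt-minimal j k p j≢k)))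

updateAt-∈ : ∀ {m n} {p : Fin m → Fin n} {u} {A : Subset n} k → (∀ i → p i ∈ A) → u ∈ A →
  ∀ i → updateAt p k (const u) i ∈ A
updateAt-∈ {p = p} {u} {A} k p∈A u∈A i with i ≟ k
... | yes refl = subst (_∈ A) (sym (updateAt-updates k p)) u∈A
... | no  i≢k  = subst (_∈ A) (sym (updateAt-minimal i k p i≢k)) (p∈A i)

lincomb-⁅⁆ : ∀ {m n} (g : Fin m → Row n) u v → lincomb (lookup ⁅ u ⁆) g v ≡ g u v
lincomb-⁅⁆ {suc m} g u v = trans
  (sum-single _ u (λ i i≢u → cong (_∧ g i v) (lookup-⁅⁆-≢ i≢u)))
  (cong (_∧ g u v) ([]=⇒lookup (x∈⁅x⁆ u)))

selection : ∀ {m n} → (Fin m → Bool) → (Fin m → Fin n) → Subset n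
selection c p = tabulate (lincomb c (λ i → lookup ⁅ p i ⁆))

lincomb-selection : ∀ {m n k} c (p : Fin m → Fin n) (g : Fin n → Row k) v →
  lincomb (lookup (selection c p)) g v ≡ lincomb c (g ∘ p) v
lincomb-selection c p g v = begin
  lincomb (lookup (selection c p)) g v
    ≡⟨ sum-cong-≗ (λ u → cong (_∧ g u v) (lookup∘tabulate _ u)) ⟩
  lincomb (lincomb c (λ i → lookup ⁅ p i ⁆)) g v
    ≡⟨ sym (lincomb-assoc c (λ i → lookup ⁅ p i ⁆) g v) ⟩
  lincomb c (λ i → lincomb (lookup ⁅ p i ⁆) g) v
    ≡⟨ sum-cong-≗ (λ i → cong (c i ∧_) (lincomb-⁅⁆ g (p i) v)) ⟩
  lincomb c (g ∘ p) v                               ∎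
  where open ≡-Reasoning

lookup-selection : ∀ {m n} c {p : Fin m → Fin n} → Injective _≡_ _≡_ p → ∀ k →
  lookup (selection c p) (p k) ≡ c k
lookup-selection {suc m} c {p} p-inj k = begin
  lookup (selection c p) (p k)               ≡⟨ lookup∘tabulate _ (p k) ⟩
  lincomb c (λ i → lookup ⁅ p i ⁆) (p k)    ≡⟨ sum-single _ k off-k ⟩
  c k ∧ lookup ⁅ p k ⁆ (p k)                ≡⟨ cong (c k ∧_) ([]=⇒lookup (x∈⁅x⁆ (p k))) ⟩
  c k ∧ true                                 ≡⟨ ∧-identityʳ (c k) ⟩
  c k                                        ∎
  where
  open ≡-Reasoning
  off-k : ∀ i → i ≢ k → c i ∧ lookup ⁅ p i ⁆ (p k) ≡ false
  off-k i i≢k = trans (cong (c i ∧_) (lookup-⁅⁆-≢ (λ e → i≢k (p-inj (sym e))))) (∧-zeroʳ (c i))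

∈selection⇒ : ∀ {m n} c (p : Fin m → Fin n) {u} → u ∈ selection c p → ∃ λ i → c i ≡ true × u ≡ p i
∈selection⇒ c p {u} u∈ with lincomb-true c (λ i → lookup ⁅ p i ⁆) u
                              (trans (sym (lookup∘tabulate _ u)) ([]=⇒lookup u∈))
... | i , cᵢ , u∈⁅pᵢ⁆ = i , cᵢ , x∈⁅y⁆⇒x≡y (p i) (lookup⇒[]= u _ u∈⁅pᵢ⁆)

selection⊆ : ∀ {m n} c {p : Fin m → Fin n} {A : Subset n} → (∀ i → p i ∈ A) → selection c p ⊆ A
selection⊆ c {p} p∈A u∈ with ∈selection⇒ c p u∈
... | i , _ , refl = p∈A i

lincomb-reindex : ∀ {m n k} (T : Subset n) {p : Fin m → Fin n} → Injective _≡_ _≡_ p →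
  (∀ {u} → u ∈ T → ∃ λ i → u ≡ p i) → (g : Fin n → Row k) →
  ∀ v → lincomb (lookup T) g v ≡ lincomb (lookup T ∘ p) (g ∘ p) v
lincomb-reindex T {p} p-inj T⊆p g v =
  trans (sum-cong-≗ (λ u → cong (_∧ g u v) (T≗selection u))) (lincomb-selection (lookup T ∘ p) p g v)
  where
  T≗selection : ∀ u → lookup T u ≡ lookup (selection (lookup T ∘ p) p) u
  T≗selection u with lookup T u in e
  ... | true with T⊆p (lookup⇒[]= u T e)
  ...   | k , refl = sym (trans (lookup-selection (lookup T ∘ p) p-inj k) e)
  T≗selection u | false with lookup (selection (lookup T ∘ p) p) u in e′
  ...   | false = refl
  ...   | true with ∈selection⇒ (lookup T ∘ p) p (lookup⇒[]= u _ e′)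
  ...     | i , Tpᵢ , refl = sym (trans (sym Tpᵢ) e)

InSpan-⊆ : ∀ {m n} {C K : Subset n} (f : Fin m → Row n) {h} → C ⊆ K → InSpan K f h → InSpan C f h
InSpan-⊆ f C⊆K (σ , h≡σf) = σ , λ v v∈C → h≡σf v (C⊆K v∈C)

InSpan-generator : ∀ {m n} {K : Subset n} (f : Fin m → Row n) k → InSpan K f (f k)
InSpan-generator f k = lookup ⁅ k ⁆ , λ v _ → sym (lincomb-⁅⁆ f k v)

InSpan-trans : ∀ {l m n} {K : Subset n} (f : Fin l → Row n) (g : Fin m → Row n) {h} →
  (∀ i → InSpan K g (f i)) → InSpan K f h → InSpan K g h
InSpan-trans f g f-span (c , h≡cf) =
  lincomb c (proj₁ ∘ f-span) ,
  λ v v∈ → trans (h≡cf v v∈) (lincomb-subst f g (proj₁ ∘ f-span) (proj₂ ∘ f-span) c v v∈)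

relation-transfer : ∀ {l m n} {K C : Subset n} (f : Fin l → Row n) (g : Fin m → Row n) →
  (∀ i → InSpan K g (f i)) → C ⊆ K →
  ∀ τ {z} → z ∈ K → lincomb τ f z ≡ true → VanishesOn C (lincomb τ f) →
  ∃ λ ρ → Nontrivial ρ × VanishesOn C (lincomb ρ g)
relation-transfer {K = K} f g f-span C⊆K τ {z} z∈K τ-at-z τ-vanishes =
  lincomb τ σ ,
  map₂ proj₁ (lincomb-true (lincomb τ σ) g z (trans (sym (τf≡ρg z∈K)) τ-at-z)) ,
  λ v v∈C → trans (sym (τf≡ρg (C⊆K v∈C))) (τ-vanishes v v∈C)
  where
  σ : Fin _ → Fin _ → Bool
  σ = proj₁ ∘ f-span
  τf≡ρg : ∀ {v} → v ∈ K → lincomb τ f v ≡ lincomb (lincomb τ σ) g v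
  τf≡ρg {v} = lincomb-subst f g σ (proj₂ ∘ f-span) τ v

-- Three vectors of GF(2)³ modulo a line

allSubsets? : ∀ {n} {P : Subset n → Set} → Decidable P → Dec (∀ p → P p)
allSubsets? P? with anySubset? (¬? ∘ P?)
... | yes (p , ¬Pp) = no (λ ∀P → ¬Pp (∀P p))
... | no ¬∃¬P       = yes (λ p → decidable-stable (P? p) (λ ¬Pp → ¬∃¬P (p , ¬Pp)))

nontrivial? : ∀ {m} (c : Fin m → Bool) → Dec (Nontrivial c)
nontrivial? c = any? (λ i → c i ≟ᵇ true)

triple : ∀ {A : Set} → A → A → A → Fin 3 → A
triple a b c zero             = a
triple a b c (suc zero)       = b
triple a b c (suc (suc zero)) = c

triple-injective : ∀ {A : Set} {a b c : A} → a ≢ b → a ≢ c → b ≢ c → Injective _≡_ _≡_ (triple a b c)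
triple-injective a≢b a≢c b≢c {zero}             {zero}             _ = refl
triple-injective a≢b a≢c b≢c {zero}             {suc zero}         e = ⊥-elim (a≢b e)
triple-injective a≢b a≢c b≢c {zero}             {suc (suc zero)}   e = ⊥-elim (a≢c e)
triple-injective a≢b a≢c b≢c {suc zero}         {zero}             e = ⊥-elim (a≢b (sym e))
triple-injective a≢b a≢c b≢c {suc zero}         {suc zero}         _ = refl
triple-injective a≢b a≢c b≢c {suc zero}         {suc (suc zero)}   e = ⊥-elim (b≢c e)
triple-injective a≢b a≢c b≢c {suc (suc zero)}   {zero}             e = ⊥-elim (a≢c (sym e))
triple-injective a≢b a≢c b≢c {suc (suc zero)}   {suc zero}         e = ⊥-elim (b≢c (sym e))
triple-injective a≢b a≢c b≢c {suc (suc zero)}   {suc (suc zero)}   _ = refl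

ReducesModulo : (Fin 3 → Fin 3 → Bool) → (Fin 3 → Bool) → (Fin 3 → Bool) → Set
ReducesModulo σ ρ c = Nontrivial c × ((∀ j → lincomb c σ j ≡ false) ⊎ (∀ j → lincomb c σ j ≡ ρ j))

reducesModulo? : ∀ σ ρ c → Dec (ReducesModulo σ ρ c)
reducesModulo? σ ρ c = nontrivial? c ×-dec
  (all? (λ j → lincomb c σ j ≟ᵇ false) ⊎-dec all? (λ j → lincomb c σ j ≟ᵇ ρ j))

reducesModulo-cong : ∀ {σ σ′ ρ ρ′} c → (∀ i j → σ i j ≡ σ′ i j) → (∀ j → ρ j ≡ ρ′ j) →
  ReducesModulo σ ρ c → ReducesModulo σ′ ρ′ c
reducesModulo-cong {σ} {σ′} c σ≡σ′ ρ≡ρ′ (c-nontrivial , reduces) = c-nontrivial , Data.Sum.map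
  (λ zero-comb j → trans (sym (comb≡ j)) (zero-comb j))
  (λ ρ-comb j → trans (sym (comb≡ j)) (trans (ρ-comb j) (ρ≡ρ′ j)))
  reduces
  where
  comb≡ : ∀ j → lincomb c σ j ≡ lincomb c σ′ j
  comb≡ j = sum-cong-≗ (λ i → cong (c i ∧_) (σ≡σ′ i j))

-- Three vectors of the plane GF(2)³/⟨ρ⟩ are dependent; checked over all 8⁴ inputs.
three-subsets-dependent-modulo : ∀ s₀ s₁ s₂ r → Nontrivial (lookup r) →
  ∃ λ c → ReducesModulo (lookup ∘ triple s₀ s₁ s₂) (lookup r) (lookup c)
three-subsets-dependent-modulo = from-yes
  (allSubsets? λ s₀ → allSubsets? λ s₁ → allSubsets? λ s₂ → allSubsets? λ r →
    nontrivial? (lookup r) →-dec anySubset? (reducesModulo? (lookup ∘ triple s₀ s₁ s₂) (lookup r) ∘ lookup))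

three-vectors-dependent-modulo : ∀ σ ρ → Nontrivial ρ → ∃ (ReducesModulo σ ρ)
three-vectors-dependent-modulo σ ρ (k , ρₖ) = transfer
  (three-subsets-dependent-modulo (rows zero) (rows (suc zero)) (rows (suc (suc zero))) (tabulate ρ)
    (k , trans (lookup∘tabulate ρ k) ρₖ))
  where
  rows : Fin 3 → Subset 3
  rows i = tabulate (σ i)
  entries : ∀ i j → lookup (triple (rows zero) (rows (suc zero)) (rows (suc (suc zero))) i) j ≡ σ i j
  entries zero             = lookup∘tabulate (σ zero)
  entries (suc zero)       = lookup∘tabulate (σ (suc zero))
  entries (suc (suc zero)) = lookup∘tabulate (σ (suc (suc zero)))
  transfer : (∃ λ c → ReducesModulo (lookup ∘ triple (rows zero) (rows (suc zero)) (rows (suc (suc zero))))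
                                     (lookup (tabulate ρ)) (lookup c)) →
             ∃ (ReducesModulo σ ρ)
  transfer (c , reduces) = lookup c , reducesModulo-cong (lookup c) entries (lookup∘tabulate ρ) reduces

-- Cut-rank

xorSum≡sum : ∀ m (t : Fin m → Bool) → xorSum m t ≡ sum t
xorSum≡sum zero    t = refl
xorSum≡sum (suc m) t = cong (t zero xor_) (xorSum≡sum m (t ∘ suc))

rowSum≡ : ∀ {n} (G : Graph n) W X T v →
  rowSum G W X T v ≡ (v ∈ᵇ (W ─ X)) ∧ lincomb (lookup T) (adj G) v
rowSum≡ {n} G W X T v = begin
  xorSum n (λ u → lookup T u ∧ (K v ∧ adj G u v))
    ≡⟨ xorSum≡sum n _ ⟩
  sum (λ u → lookup T u ∧ (K v ∧ adj G u v))
    ≡⟨ sum-cong-≗ (λ u → ∧-left-comm (lookup T u) (K v) (adj G u v)) ⟩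
  sum (λ u → K v ∧ (lookup T u ∧ adj G u v))
    ≡⟨ sym (*-distribˡ-sum (K v) (λ u → lookup T u ∧ adj G u v)) ⟩
  K v ∧ lincomb (lookup T) (adj G) v               ∎
  where
  open ≡-Reasoning
  K : Fin n → Bool
  K = lookup (W ─ X)
  ∧-left-comm : ∀ x y z → x ∧ (y ∧ z) ≡ y ∧ (x ∧ z)
  ∧-left-comm x y z = trans (sym (∧-assoc x y z)) (trans (cong (_∧ z) (∧-comm x y)) (∧-assoc y x z))

vanishing⇒rowSum≡false : ∀ {n} (G : Graph n) W X T →
  VanishesOn (W ─ X) (lincomb (lookup T) (adj G)) → ∀ v → rowSum G W X T v ≡ false
vanishing⇒rowSum≡false G W X T vanishes v rewrite rowSum≡ G W X T v with lookup (W ─ X) v in e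
... | true  = vanishes v (lookup⇒[]= v (W ─ X) e)
... | false = refl

rowSum≡false⇒vanishing : ∀ {n} (G : Graph n) W X T →
  (∀ v → rowSum G W X T v ≡ false) → VanishesOn (W ─ X) (lincomb (lookup T) (adj G))
rowSum≡false⇒vanishing G W X T zero-sum v v∈ =
  trans (cong (_∧ lincomb (lookup T) (adj G) v) (sym ([]=⇒lookup v∈)))
        (trans (sym (rowSum≡ G W X T v)) (zero-sum v))

RowDependency : ∀ {n} → Graph n → Subset n → Subset n → Subset n → Subset n → Set
RowDependency G W X S T = T ⊆ S × Nonempty T × (∀ v → rowSum G W X T v ≡ false)

rowDependency? : ∀ {n} (G : Graph n) W X S → Decidable (RowDependency G W X S)
rowDependency? G W X S T = (T ⊆? S) ×-dec (nonempty? T ×-dec all? (λ v → rowSum G W X T v ≟ᵇ false))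

independent? : ∀ {n} (G : Graph n) W X S → Dec (RowsIndependent G W X S)
independent? G W X S = map′ from to (¬? (anySubset? (rowDependency? G W X S)))
  where
  from : ¬ ∃ (RowDependency G W X S) → RowsIndependent G W X S
  from ¬dep T T⊆S T≢∅ zero-sum = ¬dep (T , T⊆S , T≢∅ , zero-sum)
  to : RowsIndependent G W X S → ¬ ∃ (RowDependency G W X S)
  to indep (T , T⊆S , T≢∅ , zero-sum) = indep T T⊆S T≢∅ zero-sum

¬independent⇒dependency : ∀ {n} (G : Graph n) W X S → ¬ RowsIndependent G W X S →
  ∃ λ T → T ⊆ S × Nonempty T × VanishesOn (W ─ X) (lincomb (lookup T) (adj G))
¬independent⇒dependency G W X S dependent with anySubset? (rowDependency? G W X S)
... | yes (T , T⊆S , T≢∅ , zero-sum) = T , T⊆S , T≢∅ , rowSum≡false⇒vanishing G W X T zero-sum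
... | no ¬dep = ⊥-elim (dependent (λ T T⊆S T≢∅ zero-sum → ¬dep (T , T⊆S , T≢∅ , zero-sum)))

largest : ∀ {P : ℕ → Set} → Decidable P → P 0 → ∀ m → (∀ k → m < k → ¬ P k) →
  ∃ λ r → P r × (∀ k → r < k → ¬ P k)
largest P? P0 m above with P? m
... | yes Pm = m , Pm , above
largest P? P0 zero    above | no ¬P0 = ⊥-elim (¬P0 P0)
largest {P} P? P0 (suc m) above | no ¬Pm+1 = largest P? P0 m above′
  where
  above′ : ∀ k → m < k → ¬ P k
  above′ k m<k with k ≟ℕ suc m
  ... | yes refl = ¬Pm+1
  ... | no k≢m+1 = above k (≤∧≢⇒< m<k (λ e → k≢m+1 (sym e)))

HasIndependentRows : ∀ {n} → Graph n → Subset n → Subset n → ℕ → Set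
HasIndependentRows G W X k = ∃ λ S → S ⊆ X × ∣ S ∣ ≡ k × RowsIndependent G W X S

hasIndependentRows? : ∀ {n} (G : Graph n) W X → Decidable (HasIndependentRows G W X)
hasIndependentRows? G W X k =
  anySubset? (λ S → (S ⊆? X) ×-dec ((∣ S ∣ ≟ℕ k) ×-dec independent? G W X S))

cutRank-exists : ∀ {n} (G : Graph n) W X → ∃ (CutRank G W X)
cutRank-exists {n} G W X = maximal (largest (hasIndependentRows? G W X) no-rows n beyond-n)
  where
  no-rows : HasIndependentRows G W X 0
  no-rows = ⊥ , ⊆-min X , ∣⊥∣≡0 n , λ { T T⊆⊥ (u , u∈T) _ → ∉⊥ (T⊆⊥ u∈T) }
  beyond-n : ∀ k → n < k → ¬ HasIndependentRows G W X k
  beyond-n k n<k (S , _ , refl , _) = <⇒≱ n<k (∣p∣≤n S)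
  maximal : (∃ λ r → HasIndependentRows G W X r × (∀ k → r < k → ¬ HasIndependentRows G W X k)) →
    ∃ (CutRank G W X)
  maximal (r , basis , above) = r , basis , bounded
    where
    bounded : ∀ S → S ⊆ X → RowsIndependent G W X S → ∣ S ∣ ≤ r
    bounded S S⊆X independent with ∣ S ∣ ≤? r
    ... | yes ∣S∣≤r = ∣S∣≤r
    ... | no  ∣S∣≰r = ⊥-elim (above ∣ S ∣ (≰⇒> ∣S∣≰r) (S , S⊆X , refl , independent))

nonvanishing⇒witness : ∀ {n} {K : Subset n} {f : Row n} → ¬ VanishesOn K f → ∃ λ v → v ∈ K × f v ≡ true
nonvanishing⇒witness {n} {K} {f} ¬vanishes with any? (λ v → (v ∈? K) ×-dec (f v ≟ᵇ true))
... | yes witness = witness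
... | no ¬witness = ⊥-elim (¬vanishes vanishes)
  where
  vanishes : VanishesOn K f
  vanishes v v∈K with f v in e
  ... | true  = ⊥-elim (¬witness (v , v∈K , e))
  ... | false = refl

independent⇒nonvanishing : ∀ {m n} (G : Graph n) {W X S} → RowsIndependent G W X S →
  {p : Fin m → Fin n} → Injective _≡_ _≡_ p → (∀ i → p i ∈ S) →
  ∀ c → Nontrivial c → ¬ VanishesOn (W ─ X) (lincomb c (adj G ∘ p))
independent⇒nonvanishing G {W} {X} independent {p} p-inj p∈S c (k , cₖ) vanishes =
  independent (selection c p) (selection⊆ c p∈S) (p k , pₖ∈selection)
    (vanishing⇒rowSum≡false G W X (selection c p)
      (λ v v∈ → trans (lincomb-selection c p (adj G) v) (vanishes v v∈)))
  where
  pₖ∈selection : p k ∈ selection c p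
  pₖ∈selection = lookup⇒[]= (p k) _ (trans (lookup-selection c p-inj k) cₖ)

independent-detects : ∀ {m n} (G : Graph n) {W X S K : Subset n} {z} → RowsIndependent G W X S →
  {p : Fin m → Fin n} → Injective _≡_ _≡_ p → (∀ i → p i ∈ S) →
  (∀ {v} → v ∈ W ─ X → v ∈ K ⊎ v ≡ z) →
  ∀ c → Nontrivial c → VanishesOn K (lincomb c (adj G ∘ p)) → lincomb c (adj G ∘ p) z ≡ true
independent-detects G independent p-inj p∈S columns c nontrivial vanishesₖ
  with nonvanishing⇒witness (independent⇒nonvanishing G independent p-inj p∈S c nontrivial)
... | v , v∈ , fᵥ with columns v∈
...   | inj₁ v∈K  = ⊥-elim (case trans (sym fᵥ) (vanishesₖ v v∈K) of λ ())
...   | inj₂ refl = fᵥ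

rank<⇒dependent : ∀ {m n} (G : Graph n) {W X r} → CutRank G W X r → r < m →
  {p : Fin m → Fin n} → Injective _≡_ _≡_ p → (∀ i → p i ∈ X) →
  ∃ λ c → Nontrivial c × VanishesOn (W ─ X) (lincomb c (adj G ∘ p))
rank<⇒dependent {m} G {W} {X} (_ , bounded) r<m {p} p-inj p∈X
  with ¬independent⇒dependency G W X image image-dependent
  where
  image : Subset _
  image = selection (const true) p
  image-dependent : ¬ RowsIndependent G W X image
  image-dependent independent = <⇒≱ r<m (≤-trans
    (injection⇒≤∣∣ p p-inj (λ i → lookup⇒[]= (p i) image (lookup-selection (const true) p-inj i)))
    (bounded image (selection⊆ (const true) p∈X) independent))
... | T , T⊆image , (u , u∈T) , vanishes = lookup T ∘ p , nontrivial , vanishes′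
  where
  T⊆p : ∀ {w} → w ∈ T → ∃ λ i → w ≡ p i
  T⊆p w∈T with ∈selection⇒ (const true) p (T⊆image w∈T)
  ... | i , _ , w≡pᵢ = i , w≡pᵢ
  nontrivial : Nontrivial (lookup T ∘ p)
  nontrivial with T⊆p u∈T
  ... | i , refl = i , []=⇒lookup u∈T
  vanishes′ : VanishesOn (W ─ X) (lincomb (lookup T ∘ p) (adj G ∘ p))
  vanishes′ v v∈ = trans (sym (lincomb-reindex T p-inj T⊆p (adj G) v)) (vanishes v v∈)

spanning-basis : ∀ {n} (G : Graph n) {W X r} → CutRank G W X r →
  ∃ λ S → S ⊆ X × ∣ S ∣ ≡ r × (∀ {u} → u ∈ X →
    ∃ λ T → T ⊆ S × (∀ v → v ∈ W ─ X → adj G u v ≡ lincomb (lookup T) (adj G) v))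
spanning-basis G {W} {X} ((S , S⊆X , ∣S∣≡r , S-independent) , bounded) = S , S⊆X , ∣S∣≡r , spans
  where
  S∪u-dependent : ∀ {u} → u ∉ S → u ∈ X → ¬ RowsIndependent G W X (S ∪ ⁅ u ⁆)
  S∪u-dependent {u} u∉S u∈X independent =
    <⇒≱ (≤-<-trans (p⊆q⇒∣p∣≤∣q∣ S⊆S∪u-u) (x∈p⇒∣p-x∣<∣p∣ (x∈p∪q⁺ {p = S} (inj₂ (x∈⁅x⁆ u)))))
        (subst (∣ S ∪ ⁅ u ⁆ ∣ ≤_) (sym ∣S∣≡r) (bounded (S ∪ ⁅ u ⁆) S∪u⊆X independent))
    where
    S⊆S∪u-u : S ⊆ (S ∪ ⁅ u ⁆) - u
    S⊆S∪u-u {t} t∈S = x∈p∧x≢y⇒x∈p-y (x∈p∪q⁺ (inj₁ t∈S)) (λ { refl → u∉S t∈S })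
    S∪u⊆X : S ∪ ⁅ u ⁆ ⊆ X
    S∪u⊆X t∈ with x∈p∪q⁻ S ⁅ u ⁆ t∈
    ... | inj₁ t∈S   = S⊆X t∈S
    ... | inj₂ t∈⁅u⁆ = subst (_∈ X) (sym (x∈⁅y⁆⇒x≡y u t∈⁅u⁆)) u∈X
  spans : ∀ {u} → u ∈ X → ∃ λ T → T ⊆ S × (∀ v → v ∈ W ─ X → adj G u v ≡ lincomb (lookup T) (adj G) v)
  spans {u} u∈X with u ∈? S
  ... | yes u∈S = ⁅ u ⁆ , (λ w∈⁅u⁆ → subst (_∈ S) (sym (x∈⁅y⁆⇒x≡y u w∈⁅u⁆)) u∈S) ,
                  (λ v _ → sym (lincomb-⁅⁆ (adj G) u v))
  ... | no  u∉S with ¬independent⇒dependency G W X (S ∪ ⁅ u ⁆) (S∪u-dependent u∉S u∈X)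
  ...   | T , T⊆S∪u , (w , w∈T) , vanishes with u ∈? T
  ...     | yes u∈T = T - u , T-u⊆S , λ v v∈ → xor≡false⇒≡ (trans (sym (split v)) (vanishes v v∈))
    where
    T-u⊆S : T - u ⊆ S
    T-u⊆S t∈T-u with x∈p∪q⁻ S ⁅ u ⁆ (T⊆S∪u (p─q⊆p T ⁅ u ⁆ t∈T-u))
    ... | inj₁ t∈S = t∈S
    ... | inj₂ t∈⁅u⁆ = ⊥-elim (x∈p─q⇒x∉q t∈T-u t∈⁅u⁆)
    split : ∀ v → lincomb (lookup T) (adj G) v ≡ adj G u v xor lincomb (lookup (T - u)) (adj G) v
    split v = trans (lincomb-split (lookup T) (adj G) u v)
      (cong₂ _xor_ (cong (_∧ adj G u v) ([]=⇒lookup u∈T))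
                   (sum-cong-≗ (λ i → cong (_∧ adj G i v) (sym (lookup-p-x T u i)))))
  ...     | no u∉T = ⊥-elim (S-independent T T⊆S (w , w∈T) (vanishing⇒rowSum≡false G W X T vanishes))
    where
    T⊆S : T ⊆ S
    T⊆S {t} t∈T with x∈p∪q⁻ S ⁅ u ⁆ (T⊆S∪u t∈T)
    ... | inj₁ t∈S = t∈S
    ... | inj₂ t∈⁅u⁆ = ⊥-elim (u∉T (subst (_∈ T) (x∈⁅y⁆⇒x≡y u t∈⁅u⁆) t∈T))

rank-two-span : ∀ {n} (G : Graph n) {W X y} → CutRank G W X 2 → y ∉ X →
  ∃ λ q₁ → ∃ λ q₂ → Injective _≡_ _≡_ (triple q₁ q₂ y) ×
    (∀ {u} → u ∈ X → InSpan (W ─ X) (adj G ∘ triple q₁ q₂ y) (adj G u))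
rank-two-span G {W} {X} {y} rank y∉X with spanning-basis G rank
... | S , S⊆X , ∣S∣≡2 , spans with 0<∣p∣⇒nonempty S (subst (0 <_) (sym ∣S∣≡2) (s≤s z≤n))
...   | q₁ , q₁∈S with ∣p∣≡2⇒pair ∣S∣≡2 q₁∈S
...     | q₂ , q₂∈S , q₂≢q₁ , S⊆q₁q₂ = q₁ , q₂ , g-injective , span
  where
  g : Fin 3 → Fin _
  g = triple q₁ q₂ y
  ≢y : ∀ {q} → q ∈ S → q ≢ y
  ≢y q∈S refl = y∉X (S⊆X q∈S)
  g-injective : Injective _≡_ _≡_ g
  g-injective = triple-injective (λ e → q₂≢q₁ (sym e)) (≢y q₁∈S) (≢y q₂∈S)
  S⊆g : ∀ {T} → T ⊆ S → ∀ {t} → t ∈ T → ∃ λ i → t ≡ g i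
  S⊆g T⊆S t∈T with S⊆q₁q₂ (T⊆S t∈T)
  ... | inj₁ t≡q₁ = zero , t≡q₁
  ... | inj₂ t≡q₂ = suc zero , t≡q₂
  span : ∀ {u} → u ∈ X → InSpan (W ─ X) (adj G ∘ g) (adj G u)
  span u∈X with spans u∈X
  ... | T , T⊆S , u≡T = lookup T ∘ g ,
        λ v v∈ → trans (u≡T v v∈) (lincomb-reindex T g-injective (S⊆g T⊆S) (adj G) v)

dependent-triple-span⇒rank≤2 : ∀ {n} (G : Graph n) {W X r} (g : Fin 3 → Row n) →
  (∀ {u} → u ∈ X → InSpan (W ─ X) g (adj G u)) →
  (∃ λ ρ → Nontrivial ρ × VanishesOn (W ─ X) (lincomb ρ g)) →
  CutRank G W X r → r ≤ 2
dependent-triple-span⇒rank≤2 G {W} {X} {r} g spans (ρ , ρ-nontrivial , ρ-vanishes)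
  ((S , S⊆X , ∣S∣≡r , S-independent) , _) with r ≤? 2
... | yes r≤2 = r≤2
... | no  r≰2 = ⊥-elim (no-three-independent (≤∣∣⇒injection S (subst (3 ≤_) (sym ∣S∣≡r) (≰⇒> r≰2))))
  where
  no-three-independent : ¬ (∃ λ (s : Fin 3 → Fin _) → Injective _≡_ _≡_ s × (∀ i → s i ∈ S))
  no-three-independent (s , s-inj , s∈S) = reduce (three-vectors-dependent-modulo σ ρ ρ-nontrivial)
    where
    σ : Fin 3 → Fin 3 → Bool
    σ i = proj₁ (spans (S⊆X (s∈S i)))
    reduce : ¬ ∃ (ReducesModulo σ ρ)
    reduce (c , c-nontrivial , reduces) =
      independent⇒nonvanishing G S-independent s-inj s∈S c c-nontrivial vanishes
      where
      vanishes : VanishesOn (W ─ X) (lincomb c (adj G ∘ s))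
      vanishes v v∈ =
        trans (lincomb-subst (adj G ∘ s) g σ (λ i → proj₂ (spans (S⊆X (s∈S i)))) c v v∈) (reduced reduces)
        where
        reduced : (∀ j → lincomb c σ j ≡ false) ⊎ (∀ j → lincomb c σ j ≡ ρ j) →
          lincomb (lincomb c σ) g v ≡ false
        reduced (inj₁ zero-comb) = sum-false _ (λ j → cong (_∧ g j v) (zero-comb j))
        reduced (inj₂ ρ-comb)    = trans (sum-cong-≗ (λ j → cong (_∧ g j v) (ρ-comb j))) (ρ-vanishes v v∈)

-- Quads

quad-relation-and-span : ∀ {n} (G : Graph n) {W P z} → Quad G W P → z ∈ P →
  {p : Fin 3 → Fin n} → Injective _≡_ _≡_ p → (∀ i → p i ∈ P - z) →
  (∃ λ τ → VanishesOn (W ─ P) (lincomb τ (adj G ∘ p)) × lincomb τ (adj G ∘ p) z ≡ true)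
  × InSpan (W ─ P) (adj G ∘ p) (adj G z)
quad-relation-and-span G {W} {P} {z} (P⊆W , ∣P∣≡4 , rank₂ , rank₃) z∈P {p} p-inj p∈P-z =
  relation-and-span (rank<⇒dependent G rank₂ ≤-refl p-inj p∈P)
  where
  p∈P : ∀ i → p i ∈ P
  p∈P i = p─q⊆p P ⁅ z ⁆ (p∈P-z i)
  p≢z : ∀ i → p i ≢ z
  p≢z i pᵢ≡z = x∈p─q⇒x∉q (p∈P-z i) (subst (_∈ ⁅ z ⁆) (sym pᵢ≡z) (x∈⁅x⁆ z))

  columns : ∀ {v} → v ∈ W ─ (P - z) → v ∈ W ─ P ⊎ v ≡ z
  columns {v} v∈ with v ≟ z
  ... | yes v≡z = inj₂ v≡z
  ... | no  v≢z = inj₁ (x∈p∧x∉q⇒x∈p─q (p─q⊆p W (P - z) v∈)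
                         (λ v∈P → x∈p─q⇒x∉q v∈ (x∈p∧x≢y⇒x∈p-y v∈P v≢z)))

  detects : ∀ c → Nontrivial c → VanishesOn (W ─ P) (lincomb c (adj G ∘ p)) → lincomb c (adj G ∘ p) z ≡ true
  detects with rank₃ z z∈P
  ... | (S , S⊆P-z , ∣S∣≡3 , S-independent) , _ =
    independent-detects G S-independent p-inj (λ i → P-z⊆S (p∈P-z i)) columns
    where
    P-z⊆S : P - z ⊆ S
    P-z⊆S = ⊆-by-size S⊆P-z (subst (_≤ ∣ S ∣) (trans ∣S∣≡3 (sym ∣P-z∣≡3)) ≤-refl)
      where
      ∣P-z∣≡3 : ∣ P - z ∣ ≡ 3
      ∣P-z∣≡3 = suc-injective (trans (sym (∣p∣≡1+∣p-x∣ P z∈P)) ∣P∣≡4)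

  fourth-row : ∀ τ k → τ k ≡ true → VanishesOn (W ─ P) (lincomb τ (adj G ∘ p)) →
    InSpan (W ─ P) (adj G ∘ p) (adj G z)
  fourth-row τ k τₖ τ-vanishes = exchange-with
    (rank<⇒dependent G rank₂ ≤-refl (updateAt-injective k p-inj p≢z) (updateAt-∈ k p∈P z∈P))
    where
    exchange-with : (∃ λ d → Nontrivial d ×
                      VanishesOn (W ─ P) (lincomb d (adj G ∘ updateAt p k (const z)))) →
      InSpan (W ─ P) (adj G ∘ p) (adj G z)
    exchange-with (d , d-nontrivial , d-vanishes) =
      exchange (adj G ∘ p) (adj G z) k detects τ τₖ τ-vanishes d d-nontrivial d-vanishes′
      where
      d-vanishes′ : VanishesOn (W ─ P) (lincomb d (updateAt (adj G ∘ p) k (const (adj G z))))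
      d-vanishes′ v v∈ = trans
        (sum-cong-≗ (λ i → cong (λ r → d i ∧ r v)
          (sym (map-updateAt-local {f = adj G} {const z} {const (adj G z)} p k refl i))))
        (d-vanishes v v∈)

  relation-and-span : (∃ λ τ → Nontrivial τ × VanishesOn (W ─ P) (lincomb τ (adj G ∘ p))) →
    (∃ λ τ → VanishesOn (W ─ P) (lincomb τ (adj G ∘ p)) × lincomb τ (adj G ∘ p) z ≡ true)
    × InSpan (W ─ P) (adj G ∘ p) (adj G z)
  relation-and-span (τ , (k , τₖ) , τ-vanishes) =
    (τ , τ-vanishes , detects τ (k , τₖ) τ-vanishes) , fourth-row τ k τₖ τ-vanishes

record Meeting {n} (P Q : Subset n) (y : Fin n) : Set where
  field
    a b z   : Fin n
    a∈P     : a ∈ P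
    a∈Q     : a ∈ Q
    b∈P     : b ∈ P
    b∈Q     : b ∈ Q
    a≢b     : a ≢ b
    z∈P     : z ∈ P
    z∉Q     : z ∉ Q
    z≢y     : z ≢ y
    P─Q⊆y,z : ∀ {w} → w ∈ P → w ∉ Q → w ≡ y ⊎ w ≡ z

meeting : ∀ {n} {P Q : Subset n} {y} → ∣ P ∣ ≡ 4 → ∣ P ∩ Q ∣ ≡ 2 → y ∈ P → y ∉ Q → Meeting P Q y
meeting {P = P} {Q} {y} ∣P∣≡4 ∣P∩Q∣≡2 y∈P y∉Q
  with ∣p∣≡2⇒pair ∣P─Q∣≡2 (x∈p∧x∉q⇒x∈p─q y∈P y∉Q)
     | 0<∣p∣⇒nonempty (P ∩ Q) (subst (0 <_) (sym ∣P∩Q∣≡2) (s≤s z≤n))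
  where
  ∣P─Q∣≡2 : ∣ P ─ Q ∣ ≡ 2
  ∣P─Q∣≡2 = sym (+-cancelˡ-≡ 2 _ _
    (trans (sym ∣P∣≡4) (trans (∣p∣≡∣p∩q∣+∣p─q∣ P Q) (cong (_+ ∣ P ─ Q ∣) ∣P∩Q∣≡2))))
... | z , z∈P─Q , z≢y , P─Q⊆y,z | a , a∈P∩Q with ∣p∣≡2⇒pair ∣P∩Q∣≡2 a∈P∩Q
...   | b , b∈P∩Q , b≢a , _ = record
  { a = a ; b = b ; z = z
  ; a∈P = proj₁ (x∈p∩q⁻ P Q a∈P∩Q) ; a∈Q = proj₂ (x∈p∩q⁻ P Q a∈P∩Q)
  ; b∈P = proj₁ (x∈p∩q⁻ P Q b∈P∩Q) ; b∈Q = proj₂ (x∈p∩q⁻ P Q b∈P∩Q)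
  ; a≢b = λ a≡b → b≢a (sym a≡b)
  ; z∈P = p─q⊆p P Q z∈P─Q ; z∉Q = x∈p─q⇒x∉q z∈P─Q ; z≢y = z≢y
  ; P─Q⊆y,z = λ w∈P w∉Q → P─Q⊆y,z (x∈p∧x∉q⇒x∈p─q w∈P w∉Q)
  }

module _ {n} {P Q : Subset n} {y} (m : Meeting P Q y) where
  open Meeting m

  private
    Q≢ : ∀ {u w} → u ∈ Q → w ∉ Q → u ≢ w
    Q≢ u∈Q w∉Q refl = w∉Q u∈Q

  meeting-injective : y ∉ Q → Injective _≡_ _≡_ (triple a b y)
  meeting-injective y∉Q = triple-injective a≢b (Q≢ a∈Q y∉Q) (Q≢ b∈Q y∉Q)

  meeting-⊆P-z : y ∈ P → ∀ i → triple a b y i ∈ P - z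
  meeting-⊆P-z y∈P zero             = x∈p∧x≢y⇒x∈p-y a∈P (Q≢ a∈Q z∉Q)
  meeting-⊆P-z y∈P (suc zero)       = x∈p∧x≢y⇒x∈p-y b∈P (Q≢ b∈Q z∉Q)
  meeting-⊆P-z y∈P (suc (suc zero)) = x∈p∧x≢y⇒x∈p-y y∈P (λ y≡z → z≢y (sym y≡z))

x∉del-x : ∀ {n} (x : Fin n) → x ∉ del x
x∉del-x x x∈ = x∈∁p⇒x∉p x∈ (x∈⁅x⁆ x)

∈del : ∀ {n} {x v : Fin n} → v ≢ x → v ∈ del x
∈del v≢x = x∉p⇒x∈∁p (x≢y⇒x∉⁅y⁆ v≢x)

union-rank≤2 : ∀ {n} (G : Graph n) {x y P Q r} → Quad G (del x) P → y ∈ P → Quad G (del y) Q →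
  Meeting P Q y → CutRank G (del x) (P ∪ Q) r → r ≤ 2
union-rank≤2 G {x} {y} {P} {Q} {r} quadP y∈P (Q⊆W′ , _ , rankQ , _) m =
  from-parts (quad-relation-and-span G quadP z∈P (meeting-injective m y∉Q) (meeting-⊆P-z m y∈P))
             (rank-two-span G rankQ y∉Q)
  where
  y∉Q : y ∉ Q
  y∉Q y∈Q = x∉del-x y (Q⊆W′ y∈Q)
  open Meeting m
  C KP KQ : Subset _
  C  = del x ─ (P ∪ Q)
  KP = del x ─ P
  KQ = del y ─ Q
  C⊆KP : C ⊆ KP
  C⊆KP v∈C = x∈p∧x∉q⇒x∈p─q (p─q⊆p (del x) (P ∪ Q) v∈C) (λ v∈P → x∈p─q⇒x∉q v∈C (x∈p∪q⁺ (inj₁ v∈P)))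
  C⊆KQ : C ⊆ KQ
  C⊆KQ {v} v∈C = x∈p∧x∉q⇒x∈p─q (∈del (λ { refl → x∈p─q⇒x∉q v∈C (x∈p∪q⁺ (inj₁ y∈P)) }))
                                  (λ v∈Q → x∈p─q⇒x∉q v∈C (x∈p∪q⁺ {p = P} (inj₂ v∈Q)))
  z∈KQ : z ∈ KQ
  z∈KQ = x∈p∧x∉q⇒x∈p─q (∈del z≢y) z∉Q
  p : Fin 3 → Fin _
  p = triple a b y

  from-parts : (∃ λ τ → VanishesOn KP (lincomb τ (adj G ∘ p)) × lincomb τ (adj G ∘ p) z ≡ true)
               × InSpan KP (adj G ∘ p) (adj G z) →
    (∃ λ q₁ → ∃ λ q₂ → Injective _≡_ _≡_ (triple q₁ q₂ y) ×
      (∀ {u} → u ∈ Q → InSpan KQ (adj G ∘ triple q₁ q₂ y) (adj G u))) →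
    CutRank G (del x) (P ∪ Q) r → r ≤ 2
  from-parts ((τ , τ-vanishes , τ-at-z) , z-span) (q₁ , q₂ , _ , Q-span) =
    dependent-triple-span⇒rank≤2 G (adj G ∘ g) spans
      (relation-transfer (adj G ∘ p) (adj G ∘ g) p-span C⊆KQ τ z∈KQ τ-at-z
        (λ v v∈C → τ-vanishes v (C⊆KP v∈C)))
    where
    g : Fin 3 → Fin _
    g = triple q₁ q₂ y
    p-span : ∀ i → InSpan KQ (adj G ∘ g) (adj G (p i))
    p-span zero             = Q-span a∈Q
    p-span (suc zero)       = Q-span b∈Q
    p-span (suc (suc zero)) = InSpan-generator (adj G ∘ g) (suc (suc zero))
    spans : ∀ {u} → u ∈ P ∪ Q → InSpan C (adj G ∘ g) (adj G u)
    spans {u} u∈P∪Q = by-membership (u ∈? Q) (x∈p∪q⁻ P Q u∈P∪Q)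
      where
      outside-Q : u ≡ y ⊎ u ≡ z → InSpan C (adj G ∘ g) (adj G u)
      outside-Q (inj₁ refl) = InSpan-generator (adj G ∘ g) (suc (suc zero))
      outside-Q (inj₂ refl) =
        InSpan-trans (adj G ∘ p) (adj G ∘ g) (λ i → InSpan-⊆ (adj G ∘ g) C⊆KQ (p-span i))
          (InSpan-⊆ (adj G ∘ p) C⊆KP z-span)
      by-membership : Dec (u ∈ Q) → u ∈ P ⊎ u ∈ Q → InSpan C (adj G ∘ g) (adj G u)
      by-membership (yes u∈Q) _          = InSpan-⊆ (adj G ∘ g) C⊆KQ (Q-span u∈Q)
      by-membership (no u∉Q)  (inj₁ u∈P) = outside-Q (P─Q⊆y,z u∈P u∉Q)
      by-membership (no u∉Q)  (inj₂ u∈Q) = ⊥-elim (u∉Q u∈Q)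

5≤∣del─X∣ : ∀ {n} (x : Fin n) {X : Subset n} → 12 ≤ n → ∣ X ∣ ≡ 6 → 5 ≤ ∣ del x ─ X ∣
5≤∣del─X∣ {n} x {X} 12≤n ∣X∣≡6 = +-cancelˡ-≤ 6 5 ∣ del x ─ X ∣
  (≤-trans (∸-monoˡ-≤ 1 12≤n)
    (subst₂ _≤_ ∣del-x∣ (cong (_+ ∣ del x ─ X ∣) ∣X∣≡6) (∣p∣≤∣q∣+∣p─q∣ (del x) X)))
  where
  ∣del-x∣ : ∣ del x ∣ ≡ n ∸ 1
  ∣del-x∣ = trans (∣∁p∣≡n∸∣p∣ ⁅ x ⁆) (cong (n ∸_) (∣⁅x⁆∣≡1 x))

∣p∪q∣≡6 : ∀ {n} (p q : Subset n) → ∣ p ∣ ≡ 4 → ∣ q ∣ ≡ 4 → ∣ p ∩ q ∣ ≡ 2 → ∣ p ∪ q ∣ ≡ 6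
∣p∪q∣≡6 p q ∣p∣≡4 ∣q∣≡4 ∣p∩q∣≡2 = +-cancelʳ-≡ 2 ∣ p ∪ q ∣ 6
  (trans (cong (∣ p ∪ q ∣ +_) (sym ∣p∩q∣≡2))
         (trans (∣p∪q∣+∣p∩q∣≡∣p∣+∣q∣ p q) (cong₂ _+_ ∣p∣≡4 ∣q∣≡4)))

lemma4p12 : ∀ {n : ℕ} (G : Graph n) → RankConnected 3 G V → 12 ≤ n →
    (x : Fin n) (P : Subset n) → Quad G (del x) P →
    (y : Fin n) → y ∈ P → (Q : Subset n) → Quad G (del y) Q →
    WeaklyThreeRankConnected G (del x) → ∣ P ∩ Q ∣ ≡ 2 → x ∈ Q
lemma4p12 G _ 12≤n x P quadP@(P⊆W , ∣P∣≡4 , _) y y∈P Q quadQ@(Q⊆W′ , ∣Q∣≡4 , _)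
  (_ , no-small-separation) ∣P∩Q∣≡2
  with x ∈? Q
... | yes x∈Q = x∈Q
... | no  x∉Q with cutRank-exists G (del x) (P ∪ Q)
...   | r , rank = ⊥-elim (no-small-separation (P ∪ Q) r P∪Q⊆W
          (subst (5 ≤_) (sym ∣P∪Q∣≡6) (n≤1+n 5)) (5≤∣del─X∣ x 12≤n ∣P∪Q∣≡6) rank
          (union-rank≤2 G quadP y∈P quadQ (meeting ∣P∣≡4 ∣P∩Q∣≡2 y∈P y∉Q) rank))
  where
  y∉Q : y ∉ Q
  y∉Q y∈Q = x∉del-x y (Q⊆W′ y∈Q)
  ∣P∪Q∣≡6 : ∣ P ∪ Q ∣ ≡ 6
  ∣P∪Q∣≡6 = ∣p∪q∣≡6 P Q ∣P∣≡4 ∣Q∣≡4 ∣P∩Q∣≡2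
  P∪Q⊆W : P ∪ Q ⊆ del x
  P∪Q⊆W u∈P∪Q with x∈p∪q⁻ P Q u∈P∪Q
  ... | inj₁ u∈P = P⊆W u∈P
  ... | inj₂ u∈Q = ∈del (λ { refl → x∉Q u∈Q })
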